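{- $K_3$ is $r$-rainbow-uncommon for all integers $r\geq 3$.
   Context: All graphs are simple. A copy of a graph $H$ in a graph $G$ is a subgraph of $G$ isomorphic to $H$. An $r$-coloring of a set $X$ is a surjective function $c:X\to\{1,\dots,r\}$. Under an edge-coloring of $G$, a subgraph $H$ is rainbow if all edges of $H$ receive pairwise distinct colors. For a graph $H$ with $e$ edges, let $M_{\mathrm{rb}}(H;n,r)$ be the maximum, over all $r$-colorings of $E(K_n)$, of the number of rainbow copies of $H$ in $K_n$; let $m_{\mathrm{rb}}(H;n,r)=M_{\mathrm{rb}}(H;n,r)/(\text{number of copies of } H \text{ in } K_n)$ and $m_{\mathrm{rb}}(H;r)=\lim_{n\to\infty} m_{\mathrm{rb}}(H;n,r)$ (this limit exists). $H$ is called $r$-rainbow-common if $m_{\mathrm{rb}}(H;r)=\binom{r}{e}e!/r^e$, and $r$-rainbow-uncommon otherwise. -}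

module Defs where

open import Data.Nat as ℕ using (ℕ; zero; suc; _*_; _∸_; _^_)
open import Data.Nat.Combinatorics using (_C_)
open import Data.Integer using (+_)
open import Data.Rational using (ℚ; _/_; 0ℚ)
open import Data.Fin using (Fin; toℕ)
open import Data.Fin.Properties using () renaming (_≟_ to _≟ᶠ_)
open import Data.List using (List; length; filter; concatMap; map; allFin)
open import Data.Product using (_×_; _,_; Σ; ∃)
open import Relation.Binary.PropositionalEquality using (_≡_; _≢_)
open import Relation.Nullary using (Dec; ¬_)
open import Relation.Nullary.Decidable using (_×-dec_; ¬?)
open import Data.Nat.Properties using (_<?_)

-- An edge-coloring of K_n with colors Fin r is given by a function
-- c : Fin n → Fin n → Fin r, required to be symmetric; the edge {i,j}
-- (i ≢ j) gets color c i j.  Diagonal values are irrelevant.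
EdgeCol : ℕ → ℕ → Set
EdgeCol n r = Fin n → Fin n → Fin r

IsRColoring : (n r : ℕ) → EdgeCol n r → Set
IsRColoring n r c =
  (∀ i j → c i j ≡ c j i) ×
  (∀ (a : Fin r) → Σ (Fin n) λ i → Σ (Fin n) λ j → (i ≢ j) × (c i j ≡ a))

allTriples : (n : ℕ) → List (Fin n × Fin n × Fin n)
allTriples n = concatMap (λ i → concatMap (λ j → map (λ k → (i , j , k)) (allFin n)) (allFin n)) (allFin n)

-- triangle {i,j,k} listed once, with i < j < k
Increasing : ∀ {n} → Fin n × Fin n × Fin n → Set
Increasing (i , j , k) = (toℕ i ℕ.< toℕ j) × (toℕ j ℕ.< toℕ k)

increasing? : ∀ {n} (t : Fin n × Fin n × Fin n) → Dec (Increasing t)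
increasing? (i , j , k) = (toℕ i <? toℕ j) ×-dec (toℕ j <? toℕ k)

Rainbow : ∀ {n r} → EdgeCol n r → Fin n × Fin n × Fin n → Set
Rainbow c (i , j , k) = (¬ c i j ≡ c i k) × (¬ c i j ≡ c j k) × (¬ c i k ≡ c j k)

rainbow? : ∀ {n r} (c : EdgeCol n r) (t : Fin n × Fin n × Fin n) → Dec (Rainbow c t)
rainbow? c (i , j , k) = ¬? (c i j ≟ᶠ c i k) ×-dec (¬? (c i j ≟ᶠ c j k) ×-dec ¬? (c i k ≟ᶠ c j k))

rainbowK3 : ∀ {n r} → EdgeCol n r → ℕ
rainbowK3 {n} c = length (filter (rainbow? c) (filter increasing? (allTriples n)))

IsMaxRainbowK3 : (n r M : ℕ) → Set
IsMaxRainbowK3 n r M =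
  (Σ (EdgeCol n r) λ c → IsRColoring n r c × (rainbowK3 c ≡ M)) ×
  (∀ (c : EdgeCol n r) → IsRColoring n r c → rainbowK3 c ℕ.≤ M)

-- a / d as a rational (with the irrelevant convention a / 0 = 0)
ratio : ℕ → ℕ → ℚ
ratio a zero = 0ℚ
ratio a (suc d) = (+ a) / suc d

copiesK3 : ℕ → ℕ
copiesK3 n = n C 3

-- the "random" value binom(r,3) 3! / r^3 = r(r-1)(r-2)/r^3
randomValueK3 : ℕ → ℚ
randomValueK3 r = ratio (r * (r ∸ 1) * (r ∸ 2)) (r ^ 3)

module Submission where

-- Split n = r²m vertices into r blocks of s = rm consecutive vertices and each block into r parts of
-- m vertices. An edge between blocks a ≠ b gets colour a + b mod r, an edge inside one block between
-- parts c and d gets colour c + d mod r. As x ↦ a + x mod r is injective on residues, a triangle is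
-- rainbow as soon as its vertices lie in three distinct blocks, or in three distinct parts of one
-- block; there are (s³ + rm³)·C(r,3) such triangles. Since C(n,3) ≤ n³/6 and 6·C(r,3) = r(r−1)(r−2),
-- the maximum M satisfies M/C(n,3) ≥ r(r−1)(r−2)/r³ + r(r−1)(r−2)/r⁵, which exceeds the random
-- value by at least 1/r⁵, for every m.

open import Defs
open import Data.Rational using (ℚ; 0ℚ; ∣_∣; _-_) renaming (_<_ to _<ℚ_; _≤_ to _≤ℚ_)
open import Data.Nat hiding (∣_-_∣)
open import Data.Nat.Properties
open import Data.Nat.DivMod
open import Data.Nat.Divisibility using (_∣_; ∣m+n∣m⇒∣n; ∣⇒≤; n∣m*n)
open import Data.Nat.Combinatorics using (_C_; nCk+nC[k+1]≡[n+1]C[k+1]; nC1≡n)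
open import Data.Nat.ListAction using (sum)
open import Data.Nat.ListAction.Properties using (sum-++)
open import Data.Nat.Tactic.RingSolver using (solve-∀; solve)
open import Data.Fin using (Fin; toℕ; fromℕ<)
open import Data.Fin.Properties using (toℕ-fromℕ<; toℕ-injective; toℕ<n; fromℕ<-cong)
open import Data.List using (List; []; _∷_; _++_; map; length; filter; concatMap; allFin; tabulate)
open import Data.List.Properties using (map-++; map-cong; map-tabulate)
open import Data.Empty using (⊥-elim)
open import Data.Product using (Σ; _×_; _,_; proj₁; proj₂)
open import Data.Sum using (_⊎_; inj₁; inj₂)
open import Function using (_∘_)
open import Algebra.Properties.CommutativeSemigroup +-commutativeSemigroup using (interchange)
open import Relation.Nullary using (¬_; yes; no)
open import Relation.Unary using (Decidable)
open import Relation.Binary.Definitions using (tri<; tri≈; tri>)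
open import Relation.Binary.PropositionalEquality

∑ : ℕ → (ℕ → ℕ) → ℕ
∑ zero    f = 0
∑ (suc n) f = f 0 + ∑ n (f ∘ suc)

∑-cong< : ∀ n {f g : ℕ → ℕ} → (∀ i → i < n → f i ≡ g i) → ∑ n f ≡ ∑ n g
∑-cong< zero    eq = refl
∑-cong< (suc n) eq = cong₂ _+_ (eq 0 z<s) (∑-cong< n (λ i i<n → eq (suc i) (s<s i<n)))

∑-cong : ∀ n {f g : ℕ → ℕ} → (∀ i → f i ≡ g i) → ∑ n f ≡ ∑ n g
∑-cong n eq = ∑-cong< n (λ i _ → eq i)

∑-+ : ∀ n (f g : ℕ → ℕ) → ∑ n (λ i → f i + g i) ≡ ∑ n f + ∑ n g
∑-+ zero    f g = refl
∑-+ (suc n) f g = trans (cong (f 0 + g 0 +_) (∑-+ n (f ∘ suc) (g ∘ suc))) (interchange (f 0) (g 0) _ _)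

∑-*ˡ : ∀ n c (f : ℕ → ℕ) → ∑ n (λ i → c * f i) ≡ c * ∑ n f
∑-*ˡ zero    c f = sym (*-zeroʳ c)
∑-*ˡ (suc n) c f = trans (cong (c * f 0 +_) (∑-*ˡ n c (f ∘ suc))) (sym (*-distribˡ-+ c (f 0) _))

∑-const : ∀ n c → ∑ n (λ _ → c) ≡ n * c
∑-const zero    c = refl
∑-const (suc n) c = cong (c +_) (∑-const n c)

∑-zero : ∀ n → ∑ n (λ _ → 0) ≡ 0
∑-zero n = trans (∑-const n 0) (*-zeroʳ n)

∑-++ : ∀ a b (f : ℕ → ℕ) → ∑ (a + b) f ≡ ∑ a f + ∑ b (λ i → f (a + i))
∑-++ zero    b f = refl
∑-++ (suc a) b f = trans (cong (f 0 +_) (∑-++ a b (f ∘ suc))) (sym (+-assoc (f 0) _ _))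

∑-blocks : ∀ r s (f : ℕ → ℕ) → ∑ (r * s) f ≡ ∑ r (λ a → ∑ s (λ t → f (a * s + t)))
∑-blocks zero    s f = refl
∑-blocks (suc r) s f = trans (∑-++ s (r * s) f) (cong (∑ s f +_) (trans (∑-blocks r s (λ i → f (s + i)))
  (∑-cong r (λ a → ∑-cong s (λ t → cong f (sym (+-assoc s (a * s) t)))))))

module _ (s : ℕ) .{{_ : NonZero s}} where

  [a*s+t]/s≡a : ∀ a {t} → t < s → (a * s + t) / s ≡ a
  [a*s+t]/s≡a a {t} t<s = begin
    (a * s + t) / s   ≡⟨ +-distrib-/-∣ˡ t (n∣m*n a) ⟩
    a * s / s + t / s ≡⟨ cong₂ _+_ (m*n/n≡m a s) (m<n⇒m/n≡0 t<s) ⟩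
    a + 0             ≡⟨ +-identityʳ a ⟩
    a                 ∎
    where open ≡-Reasoning

  [a*s+t]%s≡t : ∀ a {t} → t < s → (a * s + t) % s ≡ t
  [a*s+t]%s≡t a {t} t<s = trans (cong (_% s) (+-comm (a * s) t)) (trans ([m+kn]%n≡m%n t a s) (m<n⇒m%n≡m t<s))

  ∑-quot-rem : ∀ r (f : ℕ → ℕ → ℕ) → ∑ (r * s) (λ i → f (i / s) (i % s)) ≡ ∑ r (λ a → ∑ s (f a))
  ∑-quot-rem r f = trans (∑-blocks r s _)
    (∑-cong r (λ a → ∑-cong< s (λ t t<s → cong₂ f ([a*s+t]/s≡a a t<s) ([a*s+t]%s≡t a t<s))))

  ∑-quot : ∀ r (f : ℕ → ℕ) → ∑ (r * s) (λ i → f (i / s)) ≡ s * ∑ r f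
  ∑-quot r f = trans (∑-quot-rem r (λ a _ → f a)) (trans (∑-cong r (λ a → ∑-const s (f a))) (∑-*ˡ r s f))

  ∑-rem : ∀ r (f : ℕ → ℕ) → ∑ (r * s) (λ i → f (i % s)) ≡ r * ∑ s f
  ∑-rem r f = trans (∑-quot-rem r (λ _ → f)) (∑-const r (∑ s f))

-- Defined by recursion (not through _<?_) so that sums over a shifted range reduce by computation.
𝟙[_<_] : ℕ → ℕ → ℕ
𝟙[ _     < zero  ] = 0
𝟙[ zero  < suc _ ] = 1
𝟙[ suc a < suc b ] = 𝟙[ a < b ]

𝟙[_≡_] : ℕ → ℕ → ℕ
𝟙[ zero  ≡ zero  ] = 1
𝟙[ zero  ≡ suc _ ] = 0
𝟙[ suc _ ≡ zero  ] = 0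
𝟙[ suc a ≡ suc b ] = 𝟙[ a ≡ b ]

data Indicator (P : Set) : ℕ → Set where
  holds : P → Indicator P 1
  fails : ¬ P → Indicator P 0

Indicator-map : ∀ {P Q x} → (P → Q) → (Q → P) → Indicator P x → Indicator Q x
Indicator-map to _    (holds p)  = holds (to p)
Indicator-map _  from (fails ¬p) = fails (¬p ∘ from)

𝟙[<]-indicator : ∀ a b → Indicator (a < b) 𝟙[ a < b ]
𝟙[<]-indicator _       zero    = fails λ ()
𝟙[<]-indicator zero    (suc b) = holds z<s
𝟙[<]-indicator (suc a) (suc b) = Indicator-map s<s s<s⁻¹ (𝟙[<]-indicator a b)

𝟙[≡]-indicator : ∀ a b → Indicator (a ≡ b) 𝟙[ a ≡ b ]
𝟙[≡]-indicator zero    zero    = holds refl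
𝟙[≡]-indicator zero    (suc b) = fails λ ()
𝟙[≡]-indicator (suc a) zero    = fails λ ()
𝟙[≡]-indicator (suc a) (suc b) = Indicator-map (cong suc) suc-injective (𝟙[≡]-indicator a b)

*-indicator : ∀ {P Q x y} → Indicator P x → Indicator Q y → Indicator (P × Q) (x * y)
*-indicator (holds p)  (holds q)  = holds (p , q)
*-indicator (holds _)  (fails ¬q) = fails (¬q ∘ proj₂)
*-indicator (fails ¬p) _          = fails (¬p ∘ proj₁)

+-indicator : ∀ {P Q x y} → (P → ¬ Q) → Indicator P x → Indicator Q y → Indicator (P ⊎ Q) (x + y)
+-indicator excl (holds p)  (holds q)  = ⊥-elim (excl p q)
+-indicator _    (holds p)  (fails ¬q) = holds (inj₁ p)
+-indicator _    (fails ¬p) (holds q)  = holds (inj₂ q)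
+-indicator _    (fails ¬p) (fails ¬q) = fails λ { (inj₁ p) → ¬p p ; (inj₂ q) → ¬q q }

𝟙[≡]-select : ∀ r {b} → b < r → ∀ x → ∑ r (λ c → 𝟙[ b ≡ c ] * x) ≡ x
𝟙[≡]-select (suc r) {zero}  _   x = trans (cong (x + 0 +_) (∑-zero r)) (trans (+-identityʳ _) (+-identityʳ x))
𝟙[≡]-select (suc r) {suc b} b<r x = 𝟙[≡]-select r (s<s⁻¹ b<r) x

∑₃ : ℕ → (ℕ → ℕ → ℕ → ℕ) → ℕ
∑₃ n f = ∑ n (λ i → ∑ n (λ j → ∑ n (λ k → f i j k)))

∑₃-+ : ∀ n (f g : ℕ → ℕ → ℕ → ℕ) → ∑₃ n (λ i j k → f i j k + g i j k) ≡ ∑₃ n f + ∑₃ n g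
∑₃-+ n f g = trans (∑-cong n (λ i → trans (∑-cong n (λ j → ∑-+ n (f i j) (g i j))) (∑-+ n _ _))) (∑-+ n _ _)

module _ (s : ℕ) .{{_ : NonZero s}} where

  ∑₃-quot : ∀ r (f : ℕ → ℕ → ℕ → ℕ) →
    ∑₃ (r * s) (λ i j k → f (i / s) (j / s) (k / s)) ≡ s * (s * (s * ∑₃ r f))
  ∑₃-quot r f = begin
    ∑ (r * s) (λ i → ∑ (r * s) (λ j → ∑ (r * s) (λ k → f (i / s) (j / s) (k / s))))
      ≡⟨ ∑-cong (r * s) (λ i → ∑-cong (r * s) (λ j → ∑-quot s r (f (i / s) (j / s)))) ⟩
    ∑ (r * s) (λ i → ∑ (r * s) (λ j → s * ∑ r (f (i / s) (j / s))))
      ≡⟨ ∑-cong (r * s) (λ i → trans (∑-*ˡ (r * s) s _) (cong (s *_) (∑-quot s r (λ b → ∑ r (f (i / s) b))))) ⟩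
    ∑ (r * s) (λ i → s * (s * ∑ r (λ b → ∑ r (f (i / s) b))))
      ≡⟨ trans (∑-*ˡ (r * s) s _) (cong (s *_) (∑-*ˡ (r * s) s _)) ⟩
    s * (s * ∑ (r * s) (λ i → ∑ r (λ b → ∑ r (f (i / s) b))))
      ≡⟨ cong (λ x → s * (s * x)) (∑-quot s r (λ a → ∑ r (λ b → ∑ r (f a b)))) ⟩
    s * (s * (s * ∑₃ r f)) ∎
    where open ≡-Reasoning

  ∑-select-block : ∀ r {b} → b < r → ∀ h → ∑ (r * s) (λ k → 𝟙[ b ≡ k / s ] * h (k % s)) ≡ ∑ s h
  ∑-select-block r {b} b<r h = begin
    ∑ (r * s) (λ k → 𝟙[ b ≡ k / s ] * h (k % s)) ≡⟨ ∑-quot-rem s r (λ c t → 𝟙[ b ≡ c ] * h t) ⟩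
    ∑ r (λ c → ∑ s (λ t → 𝟙[ b ≡ c ] * h t))    ≡⟨ ∑-cong r (λ c → ∑-*ˡ s 𝟙[ b ≡ c ] h) ⟩
    ∑ r (λ c → 𝟙[ b ≡ c ] * ∑ s h)              ≡⟨ 𝟙[≡]-select r b<r (∑ s h) ⟩
    ∑ s h                                        ∎
    where open ≡-Reasoning

  ∑₃-same-block : ∀ r (g : ℕ → ℕ → ℕ → ℕ) →
    ∑₃ (r * s) (λ i j k → 𝟙[ i / s ≡ j / s ] * (𝟙[ j / s ≡ k / s ] * g (i % s) (j % s) (k % s))) ≡ r * ∑₃ s g
  ∑₃-same-block r g = begin
    ∑₃ (r * s) (λ i j k → 𝟙[ i / s ≡ j / s ] * (𝟙[ j / s ≡ k / s ] * g (i % s) (j % s) (k % s)))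
      ≡⟨ ∑-cong< (r * s) (λ i i<rs → trans (∑-cong< (r * s) (λ j j<rs →
           trans (∑-*ˡ (r * s) 𝟙[ i / s ≡ j / s ] _) (cong (𝟙[ i / s ≡ j / s ] *_) (∑-select-block r (m<n*o⇒m/o<n j<rs) _))))
           (∑-select-block r (m<n*o⇒m/o<n i<rs) (λ u → ∑ s (g (i % s) u)))) ⟩
    ∑ (r * s) (λ i → ∑ s (λ u → ∑ s (g (i % s) u)))
      ≡⟨ ∑-rem s r (λ t → ∑ s (λ u → ∑ s (g t u))) ⟩
    r * ∑₃ s g ∎
    where open ≡-Reasoning

increasing₃ : ℕ → ℕ → ℕ → ℕ
increasing₃ a b c = 𝟙[ a < b ] * 𝟙[ b < c ]

∑-increasing₂ : ∀ r → ∑ r (λ b → ∑ r (λ c → 𝟙[ b < c ])) ≡ r C 2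
∑-increasing₂ zero    = refl
∑-increasing₂ (suc r) = begin
  ∑ r (λ _ → 1) + ∑ r (λ b → ∑ r (λ c → 𝟙[ b < c ]))
    ≡⟨ cong₂ _+_ (trans (∑-const r 1) (*-identityʳ r)) (∑-increasing₂ r) ⟩
  r + r C 2                 ≡⟨ cong (_+ r C 2) (sym (nC1≡n r)) ⟩
  r C 1 + r C 2             ≡⟨ nCk+nC[k+1]≡[n+1]C[k+1] r 1 ⟩
  suc r C 2                 ∎
  where open ≡-Reasoning

∑-increasing₃ : ∀ r → ∑₃ r increasing₃ ≡ r C 3
∑-increasing₃ zero    = refl
∑-increasing₃ (suc r) = begin
  ∑₃ (suc r) increasing₃                                              ≡⟨⟩
  (∑ (suc r) (λ _ → 0) + ∑ r (λ b → ∑ r (λ c → 1 * 𝟙[ b < c ]))) +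
    ∑ r (λ a → ∑ (suc r) (λ _ → 0) + ∑ r (λ b → 𝟙[ a < b ] * 0 + ∑ r (increasing₃ a b)))
    ≡⟨ cong₂ _+_ (cong₂ _+_ (∑-zero (suc r)) (∑-cong r (λ b → ∑-cong r (λ c → *-identityˡ _))))
                 (∑-cong r (λ a → cong₂ _+_ (∑-zero (suc r)) (∑-cong r (λ b → cong (_+ ∑ r (increasing₃ a b)) (*-zeroʳ 𝟙[ a < b ]))))) ⟩
  ∑ r (λ b → ∑ r (λ c → 𝟙[ b < c ])) + ∑₃ r increasing₃              ≡⟨ cong₂ _+_ (∑-increasing₂ r) (∑-increasing₃ r) ⟩
  r C 2 + r C 3                                                       ≡⟨ nCk+nC[k+1]≡[n+1]C[k+1] r 2 ⟩
  suc r C 3                                                           ∎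
  where open ≡-Reasoning

2*nC2≡n*[n∸1] : ∀ n → 2 * (n C 2) ≡ n * (n ∸ 1)
2*nC2≡n*[n∸1] zero          = refl
2*nC2≡n*[n∸1] (suc zero)    = refl
2*nC2≡n*[n∸1] (suc (suc k)) = begin
  2 * ((2 + k) C 2)                     ≡⟨ cong (2 *_) (sym (nCk+nC[k+1]≡[n+1]C[k+1] (1 + k) 1)) ⟩
  2 * ((1 + k) C 1 + (1 + k) C 2)       ≡⟨ *-distribˡ-+ 2 ((1 + k) C 1) _ ⟩
  2 * ((1 + k) C 1) + 2 * ((1 + k) C 2) ≡⟨ cong₂ _+_ (cong (2 *_) (nC1≡n (1 + k))) (2*nC2≡n*[n∸1] (suc k)) ⟩
  2 * (1 + k) + (1 + k) * k             ≡⟨ solve (k ∷ []) ⟩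
  (2 + k) * (1 + k)                     ∎
  where open ≡-Reasoning

6*nC3≡n*[n∸1]*[n∸2] : ∀ n → 6 * (n C 3) ≡ n * (n ∸ 1) * (n ∸ 2)
6*nC3≡n*[n∸1]*[n∸2] zero                = refl
6*nC3≡n*[n∸1]*[n∸2] (suc zero)          = refl
6*nC3≡n*[n∸1]*[n∸2] (suc (suc zero))    = refl
6*nC3≡n*[n∸1]*[n∸2] (suc (suc (suc k))) = begin
  6 * ((3 + k) C 3)
    ≡⟨ cong (6 *_) (sym (nCk+nC[k+1]≡[n+1]C[k+1] (2 + k) 2)) ⟩
  6 * ((2 + k) C 2 + (2 + k) C 3)
    ≡⟨ *-distribˡ-+ 6 ((2 + k) C 2) _ ⟩
  6 * ((2 + k) C 2) + 6 * ((2 + k) C 3)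
    ≡⟨ cong (_+ 6 * ((2 + k) C 3)) (*-assoc 3 2 ((2 + k) C 2)) ⟩
  3 * (2 * ((2 + k) C 2)) + 6 * ((2 + k) C 3)
    ≡⟨ cong₂ (λ x y → 3 * x + y) (2*nC2≡n*[n∸1] (2 + k)) (6*nC3≡n*[n∸1]*[n∸2] (suc (suc k))) ⟩
  3 * ((2 + k) * (1 + k)) + (2 + k) * (1 + k) * k
    ≡⟨ solve (k ∷ []) ⟩
  (3 + k) * (2 + k) * (1 + k) ∎
  where open ≡-Reasoning

n*[n∸1]*[n∸2]>0 : ∀ {n} → 3 ≤ n → 0 < n * (n ∸ 1) * (n ∸ 2)
n*[n∸1]*[n∸2]>0 (s≤s (s≤s (s≤s _))) = z<s

nC3>0 : ∀ {n} → 3 ≤ n → 0 < n C 3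
nC3>0 {n} 3≤n = *-cancelˡ-< 6 0 (n C 3) (subst (0 <_) (sym (6*nC3≡n*[n∸1]*[n∸2] n)) (n*[n∸1]*[n∸2]>0 3≤n))

6*nC3≤n*n*n : ∀ n → 6 * (n C 3) ≤ n * n * n
6*nC3≤n*n*n n = begin
  6 * (n C 3)           ≡⟨ 6*nC3≡n*[n∸1]*[n∸2] n ⟩
  n * (n ∸ 1) * (n ∸ 2) ≤⟨ *-mono-≤ (*-monoʳ-≤ n (m∸n≤m n 1)) (m∸n≤m n 2) ⟩
  n * n * n             ∎
  where open ≤-Reasoning

Distinct₃ : ℕ → ℕ → ℕ → Set
Distinct₃ x y z = x ≢ y × x ≢ z × y ≢ z

module _ (r : ℕ) .{{_ : NonZero r}} where

  %-shift-≢ : ∀ x {d} → 0 < d → d < r → x % r ≢ (x + d) % r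
  %-shift-≢ x {d} 0<d d<r eq = <⇒≱ d<r (∣⇒≤ {{>-nonZero 0<d}} r∣d)
    where
    open ≡-Reasoning
    q₁r+d≡q₂r : x / r * r + d ≡ (x + d) / r * r
    q₁r+d≡q₂r = +-cancelˡ-≡ (x % r) _ _ (begin
      x % r + (x / r * r + d)       ≡⟨ sym (+-assoc (x % r) _ d) ⟩
      x % r + x / r * r + d         ≡⟨ cong (_+ d) (sym (m≡m%n+[m/n]*n x r)) ⟩
      x + d                         ≡⟨ m≡m%n+[m/n]*n (x + d) r ⟩
      (x + d) % r + (x + d) / r * r ≡⟨ cong (_+ (x + d) / r * r) (sym eq) ⟩
      x % r + (x + d) / r * r       ∎)
    r∣d : r ∣ d
    r∣d = ∣m+n∣m⇒∣n (subst (r ∣_) (sym q₁r+d≡q₂r) (n∣m*n ((x + d) / r))) (n∣m*n (x / r))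

  +-%-≢ : ∀ a {b c} → b < c → c < r → (a + b) % r ≢ (a + c) % r
  +-%-≢ a {b} {c} b<c c<r = subst (λ z → (a + b) % r ≢ z % r)
    (trans (+-assoc a b (c ∸ b)) (cong (a +_) (m+[n∸m]≡n (<⇒≤ b<c))))
    (%-shift-≢ (a + b) (m<n⇒0<n∸m b<c) (≤-<-trans (m∸n≤m c b) c<r))

  +-%-cancelˡ : ∀ a {b c} → b < r → c < r → (a + b) % r ≡ (a + c) % r → b ≡ c
  +-%-cancelˡ a {b} {c} b<r c<r eq with <-cmp b c
  ... | tri< b<c _ _ = ⊥-elim (+-%-≢ a b<c c<r eq)
  ... | tri≈ _ b≡c _ = b≡c
  ... | tri> _ _ c<b = ⊥-elim (+-%-≢ a c<b b<r (sym eq))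

  +-%-cancelʳ : ∀ a {b c} → b < r → c < r → (b + a) % r ≡ (c + a) % r → b ≡ c
  +-%-cancelʳ a {b} {c} b<r c<r eq =
    +-%-cancelˡ a b<r c<r (trans (cong (_% r) (+-comm a b)) (trans eq (cong (_% r) (+-comm c a))))

  pairwise-sums-distinct : ∀ {a b c} → a < r → b < r → c < r → Distinct₃ a b c →
    Distinct₃ ((a + b) % r) ((a + c) % r) ((b + c) % r)
  pairwise-sums-distinct {a} {b} {c} a<r b<r c<r (a≢b , a≢c , b≢c) =
    (b≢c ∘ +-%-cancelˡ a b<r c<r) ,
    (a≢c ∘ +-%-cancelˡ b a<r c<r ∘ trans (cong (_% r) (+-comm b a))) ,
    (a≢b ∘ +-%-cancelʳ c a<r b<r)

sum-map-++ : ∀ {A : Set} (w : A → ℕ) xs ys → sum (map w (xs ++ ys)) ≡ sum (map w xs) + sum (map w ys)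
sum-map-++ w xs ys = trans (cong sum (map-++ w xs ys)) (sum-++ (map w xs) (map w ys))

sum-map-concatMap : ∀ {A B : Set} (w : B → ℕ) (F : A → List B) xs →
  sum (map w (concatMap F xs)) ≡ sum (map (λ x → sum (map w (F x))) xs)
sum-map-concatMap w F []       = refl
sum-map-concatMap w F (x ∷ xs) =
  trans (sum-map-++ w (F x) (concatMap F xs)) (cong (sum (map w (F x)) +_) (sum-map-concatMap w F xs))

sum-map-map : ∀ {A B : Set} (w : B → ℕ) (g : A → B) xs → sum (map w (map g xs)) ≡ sum (map (w ∘ g) xs)
sum-map-map w g []       = refl
sum-map-map w g (x ∷ xs) = cong (w (g x) +_) (sum-map-map w g xs)

sum-tabulate : ∀ n (f : ℕ → ℕ) → sum (tabulate {n = n} (f ∘ toℕ)) ≡ ∑ n f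
sum-tabulate zero    f = refl
sum-tabulate (suc n) f = cong (f 0 +_) (sum-tabulate n (f ∘ suc))

sum-allFin : ∀ n (f : Fin n → ℕ) (g : ℕ → ℕ) → (∀ i → f i ≡ g (toℕ i)) → sum (map f (allFin n)) ≡ ∑ n g
sum-allFin n f g f≗g = trans (cong sum (trans (map-cong f≗g (allFin n)) (map-tabulate (λ i → i) (g ∘ toℕ))))
  (sum-tabulate n g)

onLabels : ∀ {ℓ} {A : Set ℓ} {n} → (ℕ → ℕ → ℕ → A) → Fin n × Fin n × Fin n → A
onLabels w (i , j , k) = w (toℕ i) (toℕ j) (toℕ k)

sum-allTriples : ∀ n (w : ℕ → ℕ → ℕ → ℕ) → sum (map (onLabels w) (allTriples n)) ≡ ∑₃ n w
sum-allTriples n w = trans (sum-map-concatMap (onLabels w) _ (allFin n)) (sum-allFin n _ _ λ i →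
  trans (sum-map-concatMap (onLabels w) _ (allFin n)) (sum-allFin n _ _ λ j →
  trans (sum-map-map (onLabels w) _ (allFin n)) (sum-allFin n _ _ λ k → refl)))

module _ {A : Set} {P Q R : A → Set} (P? : Decidable P) (Q? : Decidable Q) (w : A → ℕ)
         (w-indicates : ∀ x → Indicator (R x) (w x)) (R⇒Q×P : ∀ {x} → R x → Q x × P x) where

  sum-indicator≤length-filter : ∀ xs → sum (map w xs) ≤ length (filter P? (filter Q? xs))
  sum-indicator≤length-filter []       = z≤n
  sum-indicator≤length-filter (x ∷ xs) with w x | w-indicates x | Q? x
  ... | _ | holds r | no ¬q = ⊥-elim (¬q (proj₁ (R⇒Q×P r)))
  ... | _ | fails _ | no _  = sum-indicator≤length-filter xs
  ... | _ | holds r | yes _ with P? x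
  ...   | yes _ = s≤s (sum-indicator≤length-filter xs)
  ...   | no ¬p = ⊥-elim (¬p (proj₂ (R⇒Q×P r)))
  sum-indicator≤length-filter (x ∷ xs) | _ | fails _ | yes _ with P? x
  ...   | yes _ = m≤n⇒m≤1+n (sum-indicator≤length-filter xs)
  ...   | no _  = sum-indicator≤length-filter xs

-- As fractions: the conclusion reads M/N ≥ 6T/q + 1/e.
excess-bound : ∀ q e K T N M → 0 < 6 * T → 6 * N ≤ q * K → T * ((e + q) * K) ≤ M * e →
  (q + 6 * T * e) * N ≤ M * (e * q)
excess-bound q e K T N M 0<6T 6N≤qK TK≤Me = *-cancelˡ-≤ 6 (begin
  6 * ((q + 6 * T * e) * N)           ≡⟨ solve (q ∷ e ∷ T ∷ N ∷ []) ⟩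
  (q + 6 * T * e) * (6 * N)           ≤⟨ *-monoʳ-≤ (q + 6 * T * e) 6N≤qK ⟩
  (q + 6 * T * e) * (q * K)           ≤⟨ *-monoˡ-≤ (q * K) (+-monoˡ-≤ (6 * T * e) (m≤n*m q (6 * T) {{>-nonZero 0<6T}})) ⟩
  (6 * T * q + 6 * T * e) * (q * K)   ≡⟨ solve (q ∷ e ∷ K ∷ T ∷ []) ⟩
  6 * (T * ((e + q) * K) * q)         ≤⟨ *-monoʳ-≤ 6 (*-monoˡ-≤ q TK≤Me) ⟩
  6 * (M * e * q)                     ≡⟨ cong (6 *_) (*-assoc M e q) ⟩
  6 * (M * (e * q))                   ∎)
  where open ≤-Reasoning

module _ where
  open import Data.Integer as ℤ using (+_)
  import Data.Integer.Properties as ℤ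
  import Data.Rational as ℚ
  import Data.Rational.Properties as ℚ
  import Data.Rational.Unnormalised as ℚᵘ
  import Data.Rational.Unnormalised.Properties as ℚᵘ

  ratio1>0 : ∀ E → 0 < E → 0ℚ <ℚ ratio 1 E
  ratio1>0 (suc e) _ = ℚ.positive⁻¹ (ratio 1 (suc e)) {{ℚ.normalize-pos 1 (suc e)}}

  private
    toℚᵘ-ratio : ∀ a d → ℚ.toℚᵘ (ratio a (suc d)) ℚᵘ.≃ ℚᵘ.mkℚᵘ (+ a) d
    toℚᵘ-ratio a d = ℚ.toℚᵘ-fromℚᵘ (ℚᵘ.mkℚᵘ (+ a) d)

    ratio-+-≤ : ∀ M c P q e → (suc q + P * suc e) * suc c ≤ M * (suc e * suc q) →
      ratio 1 (suc e) ℚ.+ ratio P (suc q) ℚ.≤ ratio M (suc c)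
    ratio-+-≤ M c P q e h = ℚ.toℚᵘ-cancel-≤ (ℚᵘ.≤-respʳ-≃ (ℚᵘ.≃-sym (toℚᵘ-ratio M c))
      (ℚᵘ.≤-respˡ-≃ (ℚᵘ.≃-sym (ℚ.toℚᵘ-homo-+ (ratio 1 (suc e)) (ratio P (suc q))))
      (ℚᵘ.≤-respˡ-≃ (ℚᵘ.≃-sym (ℚᵘ.+-cong (toℚᵘ-ratio 1 e) (toℚᵘ-ratio P q)))
      (ℚᵘ.*≤* (subst₂ ℤ._≤_ lhs rhs (ℤ.+≤+ h))))))
      where
      lhs : + ((suc q + P * suc e) * suc c) ≡ (+ 1 ℤ.* + suc q ℤ.+ + P ℤ.* + suc e) ℤ.* + suc c
      lhs = trans (ℤ.pos-* (suc q + P * suc e) (suc c)) (cong (ℤ._* + suc c) (trans (ℤ.pos-+ (suc q) (P * suc e))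
        (cong₂ ℤ._+_ (sym (ℤ.*-identityˡ (+ suc q))) (ℤ.pos-* P (suc e)))))
      rhs : + (M * (suc e * suc q)) ≡ + M ℤ.* + (suc e * suc q)
      rhs = ℤ.pos-* M _

    p+q≤r⇒p≤r-q : ∀ {p q r} → p ℚ.+ q ℚ.≤ r → p ℚ.≤ r ℚ.- q
    p+q≤r⇒p≤r-q {p} {q} {r} h = subst (ℚ._≤ r ℚ.- q) p+q-q≡p (ℚ.+-monoˡ-≤ (ℚ.- q) h)
      where
      p+q-q≡p : p ℚ.+ q ℚ.- q ≡ p
      p+q-q≡p = trans (ℚ.+-assoc p q (ℚ.- q)) (trans (cong (p ℚ.+_) (ℚ.+-inverseʳ q)) (ℚ.+-identityʳ p))

    ≤-∣∣ : ∀ {ε x} → 0ℚ ℚ.≤ ε → ε ℚ.≤ x → ε ℚ.≤ ∣ x ∣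
    ≤-∣∣ {ε} 0≤ε ε≤x = subst (ε ℚ.≤_) (sym (ℚ.0≤p⇒∣p∣≡p (ℚ.≤-trans 0≤ε ε≤x))) ε≤x

  ratio-gap : ∀ M N P Q E → 0 < N → 0 < Q → 0 < E → (Q + P * E) * N ≤ M * (E * Q) →
    ratio 1 E ≤ℚ ∣ ratio M N - ratio P Q ∣
  ratio-gap M (suc c) P (suc q) (suc e) _ _ 0<E h =
    ≤-∣∣ (ℚ.<⇒≤ (ratio1>0 (suc e) 0<E)) (p+q≤r⇒p≤r-q (ratio-+-≤ M c P q e h))

cube-of-product : ∀ a b → a * b * (a * b) * (a * b) ≡ a * a * a * (b * b * b)
cube-of-product = solve-∀

r^3≡r*r*r : ∀ r → r ^ 3 ≡ r * r * r
r^3≡r*r*r r = trans (cong (λ x → r * (r * x)) (*-identityʳ r)) (sym (*-assoc r r r))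

randomValueK3≡6*rC3/r³ : ∀ r → randomValueK3 r ≡ ratio (6 * (r C 3)) (r * r * r)
randomValueK3≡6*rC3/r³ r = cong₂ ratio (sym (6*nC3≡n*[n∸1]*[n∸2] r)) (r^3≡r*r*r r)

module Construction (r m : ℕ) .{{_ : NonZero r}} .{{_ : NonZero m}} where

  s n : ℕ
  s = r * m
  n = r * s

  instance
    s≢0 : NonZero s
    s≢0 = m*n≢0 r m

  block part : ℕ → ℕ
  block i = i / s
  part  i = i % s / m

  block<r : ∀ {i} → i < n → block i < r
  block<r = m<n*o⇒m/o<n

  part<r : ∀ i → part i < r
  part<r i = m<n*o⇒m/o<n (m%n<n i s)

  %-mono-within-block : ∀ {i j} → block i ≡ block j → i ≤ j → i % s ≤ j % s
  %-mono-within-block {i} {j} same i≤j = +-cancelʳ-≤ (block j * s) (i % s) (j % s)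
    (subst₂ _≤_ (trans (m≡m%n+[m/n]*n i s) (cong (λ b → i % s + b * s) same)) (m≡m%n+[m/n]*n j s) i≤j)

  <-from-block : ∀ {i j} → block i < block j → i < j
  <-from-block b<b = ≰⇒> (λ j≤i → <⇒≱ b<b (/-monoˡ-≤ s j≤i))

  <-from-part : ∀ {i j} → block i ≡ block j → part i < part j → i < j
  <-from-part same p<p = ≰⇒> (λ j≤i → <⇒≱ p<p (/-monoˡ-≤ m (%-mono-within-block (sym same) j≤i)))

  colour : ℕ → ℕ → ℕ
  colour i j with block i ≟ block j
  ... | yes _ = (part i + part j) % r
  ... | no  _ = (block i + block j) % r

  colour-sym : ∀ i j → colour i j ≡ colour j i
  colour-sym i j with block i ≟ block j | block j ≟ block i
  ... | yes _ | yes _ = cong (_% r) (+-comm (part i) (part j))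
  ... | no  _ | no  _ = cong (_% r) (+-comm (block i) (block j))
  ... | yes e | no ne = ⊥-elim (ne (sym e))
  ... | no ne | yes e = ⊥-elim (ne (sym e))

  colour<r : ∀ i j → colour i j < r
  colour<r i j with block i ≟ block j
  ... | yes _ = m%n<n _ r
  ... | no  _ = m%n<n _ r

  colour-across : ∀ {i j} → block i ≢ block j → colour i j ≡ (block i + block j) % r
  colour-across {i} {j} ne with block i ≟ block j
  ... | yes e = ⊥-elim (ne e)
  ... | no  _ = refl

  colour-within : ∀ {i j} → block i ≡ block j → colour i j ≡ (part i + part j) % r
  colour-within {i} {j} e with block i ≟ block j
  ... | yes _ = refl
  ... | no ne = ⊥-elim (ne e)

  Across Within Admissible RainbowColours : ℕ → ℕ → ℕ → Set
  Across i j k = block i < block j × block j < block k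
  Within i j k = block i ≡ block j × block j ≡ block k × part i < part j × part j < part k
  Admissible i j k = Across i j k ⊎ Within i j k
  RainbowColours i j k = Distinct₃ (colour i j) (colour i k) (colour j k)

  across-rainbow : ∀ {i j k} → i < n → j < n → k < n → Across i j k → RainbowColours i j k
  across-rainbow {i} {j} {k} i<n j<n k<n (bi<bj , bj<bk)
    rewrite colour-across (<⇒≢ bi<bj) | colour-across (<⇒≢ (<-trans bi<bj bj<bk)) | colour-across (<⇒≢ bj<bk) =
    pairwise-sums-distinct r (block<r i<n) (block<r j<n) (block<r k<n)
      (<⇒≢ bi<bj , <⇒≢ (<-trans bi<bj bj<bk) , <⇒≢ bj<bk)

  within-rainbow : ∀ {i j k} → Within i j k → RainbowColours i j k
  within-rainbow {i} {j} {k} (bi≡bj , bj≡bk , pi<pj , pj<pk)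
    rewrite colour-within bi≡bj | colour-within (trans bi≡bj bj≡bk) | colour-within bj≡bk =
    pairwise-sums-distinct r (part<r i) (part<r j) (part<r k)
      (<⇒≢ pi<pj , <⇒≢ (<-trans pi<pj pj<pk) , <⇒≢ pj<pk)

  weight : ℕ → ℕ → ℕ → ℕ
  weight i j k = increasing₃ (block i) (block j) (block k)
               + 𝟙[ block i ≡ block j ] * (𝟙[ block j ≡ block k ] * increasing₃ (part i) (part j) (part k))

  weight-indicator : ∀ i j k → Indicator (Admissible i j k) (weight i j k)
  weight-indicator i j k = +-indicator (λ (bi<bj , _) (bi≡bj , _) → <⇒≢ bi<bj bi≡bj)
    (*-indicator (𝟙[<]-indicator _ _) (𝟙[<]-indicator _ _))
    (*-indicator (𝟙[≡]-indicator _ _) (*-indicator (𝟙[≡]-indicator _ _)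
      (*-indicator (𝟙[<]-indicator _ _) (𝟙[<]-indicator _ _))))

  ∑₃-weight : ∑₃ n weight ≡ s * (s * (s * (r C 3))) + r * (m * (m * (m * (r C 3))))
  ∑₃-weight = begin
    ∑₃ n weight
      ≡⟨ ∑₃-+ n _ _ ⟩
    ∑₃ n (λ i j k → increasing₃ (block i) (block j) (block k)) +
    ∑₃ n (λ i j k → 𝟙[ block i ≡ block j ] * (𝟙[ block j ≡ block k ] * increasing₃ (part i) (part j) (part k)))
      ≡⟨ cong₂ _+_ (∑₃-quot s r increasing₃) (trans (∑₃-same-block s r _) (cong (r *_) (∑₃-quot m r increasing₃))) ⟩
    s * (s * (s * ∑₃ r increasing₃)) + r * (m * (m * (m * ∑₃ r increasing₃)))
      ≡⟨ cong (λ T → s * (s * (s * T)) + r * (m * (m * (m * T)))) (∑-increasing₃ r) ⟩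
    s * (s * (s * (r C 3))) + r * (m * (m * (m * (r C 3)))) ∎
    where open ≡-Reasoning

  col : EdgeCol n r
  col i j = fromℕ< (colour<r (toℕ i) (toℕ j))

  toℕ-col : ∀ i j → toℕ (col i j) ≡ colour (toℕ i) (toℕ j)
  toℕ-col i j = toℕ-fromℕ< (colour<r (toℕ i) (toℕ j))

  rainbow-col : ∀ {i j k} → RainbowColours (toℕ i) (toℕ j) (toℕ k) → Rainbow col (i , j , k)
  rainbow-col (ij≢ik , ij≢jk , ik≢jk) = ij≢ik ∘ colour-≡ , ij≢jk ∘ colour-≡ , ik≢jk ∘ colour-≡
    where
    colour-≡ : ∀ {a b c d} → col a b ≡ col c d → colour (toℕ a) (toℕ b) ≡ colour (toℕ c) (toℕ d)
    colour-≡ {a} {b} {c} {d} e = trans (sym (toℕ-col a b)) (trans (cong toℕ e) (toℕ-col c d))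

  admissible⇒increasing-rainbow : ∀ {t} → onLabels Admissible t → Increasing t × Rainbow col t
  admissible⇒increasing-rainbow {i , j , k} (inj₁ across@(bi<bj , bj<bk)) =
    (<-from-block bi<bj , <-from-block bj<bk) , rainbow-col (across-rainbow (toℕ<n i) (toℕ<n j) (toℕ<n k) across)
  admissible⇒increasing-rainbow {i , j , k} (inj₂ within@(bi≡bj , bj≡bk , pi<pj , pj<pk)) =
    (<-from-part bi≡bj pi<pj , <-from-part bj≡bk pj<pk) , rainbow-col (within-rainbow within)

  rainbowK3-col≥ : s * (s * (s * (r C 3))) + r * (m * (m * (m * (r C 3)))) ≤ rainbowK3 col
  rainbowK3-col≥ = subst (_≤ rainbowK3 col) (trans (sum-allTriples n weight) ∑₃-weight)
    (sum-indicator≤length-filter (rainbow? col) increasing? (onLabels weight)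
      (λ { (i , j , k) → weight-indicator (toℕ i) (toℕ j) (toℕ k) }) admissible⇒increasing-rainbow (allTriples n))

  blockVertex : ∀ {a} → a < r → Fin n
  blockVertex a<r = fromℕ< (*-monoˡ-< s a<r)

  block-blockVertex : ∀ {a} (a<r : a < r) → block (toℕ (blockVertex a<r)) ≡ a
  block-blockVertex {a} a<r = trans (cong block (toℕ-fromℕ< (*-monoˡ-< s a<r))) (m*n/n≡m a s)

  col-between-blocks : ∀ {a b} (a<r : a < r) (b<r : b < r) → a ≢ b → ∀ x → (a + b) % r ≡ toℕ x →
    Σ (Fin n) λ i → Σ (Fin n) λ j → i ≢ j × col i j ≡ x
  col-between-blocks {a} {b} a<r b<r a≢b x a+b≡x =
    blockVertex a<r , blockVertex b<r , a≢b ∘ blocks-≡ ∘ cong (block ∘ toℕ) , toℕ-injective (begin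
      toℕ (col (blockVertex a<r) (blockVertex b<r)) ≡⟨ toℕ-col _ _ ⟩
      colour (toℕ (blockVertex a<r)) (toℕ (blockVertex b<r)) ≡⟨ colour-across (a≢b ∘ blocks-≡) ⟩
      (block (toℕ (blockVertex a<r)) + block (toℕ (blockVertex b<r))) % r
        ≡⟨ cong₂ (λ u v → (u + v) % r) (block-blockVertex a<r) (block-blockVertex b<r) ⟩
      (a + b) % r ≡⟨ a+b≡x ⟩
      toℕ x ∎)
    where
    open ≡-Reasoning
    blocks-≡ : block (toℕ (blockVertex a<r)) ≡ block (toℕ (blockVertex b<r)) → a ≡ b
    blocks-≡ e = trans (sym (block-blockVertex a<r)) (trans e (block-blockVertex b<r))

  -- Colour 0 joins blocks 1 and r − 1 (here r ≥ 3 is needed), colour t + 1 joins blocks 0 and t + 1.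
  col-surjective : 3 ≤ r → ∀ x → Σ (Fin n) λ i → Σ (Fin n) λ j → i ≢ j × col i j ≡ x
  col-surjective 3≤r x with toℕ x in toℕx≡
  ... | zero  = col-between-blocks 1<r (∸-monoʳ-< z<s (<⇒≤ 1<r)) (<⇒≢ 1<r∸1) x
      (trans (cong (_% r) (m+[n∸m]≡n (<⇒≤ 1<r))) (trans (n%n≡0 r) (sym toℕx≡)))
    where
    1<r : 1 < r
    1<r = <-≤-trans (s≤s (s≤s z≤n)) 3≤r
    1<r∸1 : 1 < r ∸ 1
    1<r∸1 = ∸-monoˡ-< 3≤r (s≤s z≤n)
  ... | suc t = col-between-blocks (<-≤-trans z<s 3≤r) t+1<r (λ ()) x (trans (m<n⇒m%n≡m t+1<r) (sym toℕx≡))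
    where
    t+1<r : suc t < r
    t+1<r = subst (_< r) toℕx≡ (toℕ<n x)

  col-isRColoring : 3 ≤ r → IsRColoring n r col
  col-isRColoring 3≤r =
    (λ i j → fromℕ<-cong _ _ (colour-sym (toℕ i) (toℕ j)) _ _) , col-surjective 3≤r

  m≤n : m ≤ n
  m≤n = ≤-trans (m≤n*m m r) (m≤n*m s r)

  far-from-random : 3 ≤ r → ∀ M → rainbowK3 col ≤ M →
    ratio 1 (r * r * (r * r * r)) ≤ℚ ∣ ratio M (copiesK3 n) - randomValueK3 r ∣
  far-from-random 3≤r M col≤M = subst (λ ρ → ratio 1 r⁵ ≤ℚ ∣ ratio M (n C 3) - ρ ∣) (sym (randomValueK3≡6*rC3/r³ r))
    (ratio-gap M (n C 3) (6 * (r C 3)) (r * r * r) r⁵ (nC3>0 3≤n) r³>0 r⁵>0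
      (excess-bound (r * r * r) r⁵ (s * s * s) (r C 3) (n C 3) M (*-monoʳ-< 6 (nC3>0 3≤r))
        (subst (6 * (n C 3) ≤_) (cube-of-product r s) (6*nC3≤n*n*n n))
        (subst (_≤ M * r⁵) (rearrange r m (r C 3)) (*-monoˡ-≤ r⁵ (≤-trans rainbowK3-col≥ col≤M)))))
    where
    r⁵ : ℕ
    r⁵ = r * r * (r * r * r)
    3≤n : 3 ≤ n
    3≤n = ≤-trans 3≤r (m≤m*n r s)
    r>0 : 0 < r
    r>0 = <-≤-trans z<s 3≤r
    r³>0 : 0 < r * r * r
    r³>0 = *-mono-< (*-mono-< r>0 r>0) r>0
    r⁵>0 : 0 < r⁵
    r⁵>0 = *-mono-< (*-mono-< r>0 r>0) r³>0
    rearrange : ∀ r m T → (r * m * (r * m * (r * m * T)) + r * (m * (m * (m * T)))) * (r * r * (r * r * r))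
                        ≡ T * ((r * r * (r * r * r) + r * r * r) * (r * m * (r * m) * (r * m)))
    rearrange = solve-∀

proposition5 : (r : ℕ) → r ≥ 3 →
    Σ ℚ λ ε → (0ℚ <ℚ ε) ×
      ((N : ℕ) → Σ ℕ λ n → (n ≥ N) ×
        ((M : ℕ) → IsMaxRainbowK3 n r M →
          ε ≤ℚ ∣ ratio M (copiesK3 n) - randomValueK3 r ∣))
proposition5 r 3≤r@(s≤s (s≤s (s≤s _))) = ratio 1 (r * r * (r * r * r)) , ratio1>0 (r * r * (r * r * r)) z<s , λ N →
  let open Construction r (suc N) in
  n , ≤-trans (n≤1+n N) m≤n , λ M (_ , maximal) → far-from-random 3≤r M (maximal col (col-isRColoring 3≤r))
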